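{- Let $m\ge 2$ and let $\mathbf{P}=(X_1,\ldots,X_m;\preceq)$ be an $m$-partite poset. Then \[ \dim(\mathbf{P})\leq \sum_{1\le i<j\le m}\dim(\mathbf{P}_{i,j}). \]
   Context: All posets are finite. The order dimension $\dim(\mathbf{Q})$ of a poset $\mathbf{Q}=(X,\preceq)$ is the least number $d$ of linear extensions $\preceq_1,\ldots,\preceq_d$ of $\preceq$ such that for all $x,y\in X$: $x\preceq y$ iff $x\preceq_i y$ for all $i\in[d]$. For an integer $m\geq 2$ and disjoint nonempty sets $X_1,\ldots,X_m$, $\mathbf{P}=(X_1,\ldots,X_m;\preceq)$ is an $m$-partite poset if $\preceq$ is a partial order on $X=X_1\cup\cdots\cup X_m$ such that (1) each $X_i$ is an antichain, and (2) $x\prec y$ implies $x\in X_i$, $y\in X_j$ with $i<j$. Its dimension is that of $(X,\preceq)$. For $i<j$, $\mathbf{P}_{i,j}$ is the sub-poset induced on $X_i\cup X_j$. -}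

module Defs where

open import Level using (0ℓ)
open import Data.Nat using (ℕ; zero; suc; _+_)
open import Data.Fin using (Fin; _<_; _<?_)
open import Data.Product using (Σ; ∃; _×_; proj₁)
open import Data.Sum using (_⊎_)
open import Relation.Nullary using (yes; no)
open import Relation.Binary using (Rel; IsPartialOrder; IsTotalOrder)
open import Relation.Binary.PropositionalEquality using (_≡_; _≢_)
open import Function.Bundles using (_⇔_)
import Data.Nat as ℕ

record IsLinearExtension {A : Set} (_≤_ : Rel A 0ℓ) (_≤′_ : Rel A 0ℓ) : Set where
  field
    isTotalOrder : IsTotalOrder _≡_ _≤′_
    extends      : ∀ {x y} → x ≤ y → x ≤′ y

HasRealizer : {A : Set} → Rel A 0ℓ → ℕ → Set₁
HasRealizer {A} _≤_ d =
  Σ (Fin d → Rel A 0ℓ) λ L →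
    (∀ k → IsLinearExtension _≤_ (L k)) ×
    (∀ x y → (x ≤ y) ⇔ (∀ k → L k x y))

IsDimension : {A : Set} → Rel A 0ℓ → ℕ → Set₁
IsDimension _≤_ d = HasRealizer _≤_ d × (∀ d′ → HasRealizer _≤_ d′ → d ℕ.≤ d′)

-- m-partite poset on the finite ground set Fin n;
-- part x = the index of the block X_i containing x (blocks are disjoint and cover).
record IsMPartite (m n : ℕ) (part : Fin n → Fin m) (_≼_ : Rel (Fin n) 0ℓ) : Set where
  field
    isPartialOrder : IsPartialOrder _≡_ _≼_
    nonempty       : ∀ i → ∃ λ x → part x ≡ i
    antichain      : ∀ x y → part x ≡ part y → x ≼ y → x ≡ y
    upward         : ∀ x y → x ≼ y → x ≢ y → part x < part y

PairCarrier : {m n : ℕ} → (Fin n → Fin m) → Fin m → Fin m → Set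
PairCarrier {n = n} part i j = Σ (Fin n) λ x → part x ≡ i ⊎ part x ≡ j

pairRel : {m n : ℕ} (part : Fin n → Fin m) → Rel (Fin n) 0ℓ →
          (i j : Fin m) → Rel (PairCarrier part i j) 0ℓ
pairRel part _≼_ i j a b = proj₁ a ≼ proj₁ b

sumFin : (n : ℕ) → (Fin n → ℕ) → ℕ
sumFin zero    f = 0
sumFin (suc n) f = f Fin.zero + sumFin n (λ k → f (Fin.suc k))
  where import Data.Fin as Fin

sumPairs : (m : ℕ) → (Fin m → Fin m → ℕ) → ℕ
sumPairs m D = sumFin m λ i → sumFin m λ j → lt i j
  where
  lt : Fin m → Fin m → ℕ
  lt i j with i <? j
  ... | yes _ = D i j
  ... | no  _ = 0

-- For every pair i < j fix a realizer of P_{i,j}.  Each of its linear extensions L, an order on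
-- X_i ∪ X_j, is extended to a linear extension of P that agrees with L on X_i ∪ X_j: take any linear
-- extension of the partial order "x ≼ y, or x ≼ a, a before b in L, b ≼ y".  The extensions obtained
-- for all pairs realize P: if x precedes y in all of them, choose a pair i < j whose blocks contain x
-- and y (this needs m ≥ 2 when x and y lie in the same block); then x precedes y in every linear
-- extension of the realizer of P_{i,j}, hence x ≼ y.
module Submission where

open import Defs
open import Data.Nat using (ℕ; _≤_)
open import Data.Fin using (Fin; _<_)
open import Level using (Level; 0ℓ)
open import Relation.Binary using (Rel)

open import Data.Nat using (zero; suc; s≤s; z<s; _*_)
open import Data.Nat.Properties using (<⇒≤; <⇒≱) renaming (≤-refl to ℕ-≤-refl)
open import Data.Fin as F using (_<?_; fromℕ<; combine)
open import Data.Fin.Properties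
  using (_≟_; any?; all?; <-cmp; <⇒≢; <-irrelevant; ≤-isTotalOrder; toℕ-fromℕ<;
         combine-monoˡ-<; combine-injectiveʳ)
open import Data.Fin.Subset using (Subset; _∈_; _⊂_)
open import Data.Fin.Subset.Properties using (∣p∣≤n; p⊂q⇒∣p∣<∣q∣)
open import Data.Vec using (tabulate)
open import Data.Vec.Properties using (lookup∘tabulate; []=⇒lookup; lookup⇒[]=)
open import Data.Vec.Functional using (Vector; []; _++_)
open import Data.Vec.Functional.Relation.Unary.All using (All)
open import Data.Vec.Functional.Relation.Unary.All.Properties using (++⁺; ++⁻ˡ; ++⁻ʳ)
open import Data.Product using (Σ; ∃; ∃₂; _×_; _,_; proj₁; proj₂)
open import Data.Sum using (_⊎_; inj₁; inj₂)
open import Data.Empty using (⊥-elim)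
open import Function using (_∘_; _on_)
open import Function.Bundles using (mk⇔; Equivalence)
open import Function.Definitions using (Injective)
open import Relation.Nullary using (Dec; yes; no; does)
open import Relation.Nullary.Decidable using (map′; dec-true; _⊎-dec_; _×-dec_)
open import Relation.Nullary.Irrelevant using (Irrelevant)
open import Relation.Unary using (Pred)
import Relation.Unary as U
open import Relation.Binary
  using (Decidable; DecidableEquality; IsTotalOrder; IsPartialOrder; IsDecPartialOrder;
         tri<; tri≈; tri>)
open import Relation.Binary.Consequences using (total∧dec⇒dec)
open import Relation.Binary.PropositionalEquality
  using (_≡_; _≢_; refl; sym; trans; cong; subst; subst₂; isEquivalence)

private
  variable
    a ℓ : Level
    A B : Set a
    k m n : ℕ

concat : (g : Fin k → ℕ) → ((i : Fin k) → Vector A (g i)) → Vector A (sumFin k g)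
concat {k = zero}  g V = []
concat {k = suc k} g V = V F.zero ++ concat (g ∘ F.suc) (V ∘ F.suc)

module _ (P : Pred A ℓ) where

  All-concat⁺ : {g : Fin k → ℕ} {V : (i : Fin k) → Vector A (g i)} →
                (∀ i → All P (V i)) → All P (concat g V)
  All-concat⁺ {k = suc k} PV = ++⁺ P (PV F.zero) (All-concat⁺ (PV ∘ F.suc))

  All-concat⁻ : {g : Fin k → ℕ} (V : (i : Fin k) → Vector A (g i)) →
                All P (concat g V) → ∀ i → All P (V i)
  All-concat⁻ {k = suc k} V PV F.zero    = ++⁻ˡ P (V F.zero) PV
  All-concat⁻ {k = suc k} V PV (F.suc i) = All-concat⁻ (V ∘ F.suc) (++⁻ʳ P (V F.zero) PV) i

-- The summand of sumPairs is local to its definition; unification recovers it.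
sumPairs-summands : (m : ℕ) (D : Fin m → Fin m → ℕ) →
                    Σ (Fin m → Fin m → ℕ) λ d → sumPairs m D ≡ sumFin m (λ i → sumFin m (d i))
sumPairs-summands m D = _ , refl

pairSummand : (m : ℕ) → (Fin m → Fin m → ℕ) → Fin m → Fin m → ℕ
pairSummand m D = proj₁ (sumPairs-summands m D)

module _ {D : Fin m → Fin m → ℕ} where

  guarded : (i j : Fin m) → (i < j → Vector A (D i j)) → Vector A (pairSummand m D i j)
  guarded i j V with i <? j
  ... | yes i<j = V i<j
  ... | no  _   = []

  pairFamily : (∀ i j → i < j → Vector A (D i j)) → Vector A (sumPairs m D)
  pairFamily V = concat _ λ i → concat _ λ j → guarded i j (V i j)

  module _ (P : Pred A ℓ) where

    All-guarded⁺ : (i j : Fin m) (V : i < j → Vector A (D i j)) →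
                   (∀ i<j → All P (V i<j)) → All P (guarded i j V)
    All-guarded⁺ i j V PV with i <? j
    ... | yes i<j = PV i<j
    ... | no  _   = λ ()

    All-guarded⁻ : (i j : Fin m) (V : i < j → Vector A (D i j)) →
                   All P (guarded i j V) → ∀ i<j → All P (V i<j)
    All-guarded⁻ i j V PV i<j with i <? j
    ... | yes i<j′ = subst (λ p → All P (V p)) (<-irrelevant i<j′ i<j) PV
    ... | no  i≮j  = ⊥-elim (i≮j i<j)

    All-pairFamily⁺ : (V : ∀ i j → i < j → Vector A (D i j)) →
                      (∀ i j i<j → All P (V i j i<j)) → All P (pairFamily V)
    All-pairFamily⁺ V PV =
      All-concat⁺ P λ i → All-concat⁺ P λ j → All-guarded⁺ i j (V i j) (PV i j)

    All-pairFamily⁻ : (V : ∀ i j → i < j → Vector A (D i j)) →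
                      All P (pairFamily V) → ∀ i j i<j → All P (V i j i<j)
    All-pairFamily⁻ V PV i j =
      All-guarded⁻ i j (V i j) (All-concat⁻ P _ (All-concat⁻ P _ PV i) j)

realizer⇒decidable : {_≤_ : Rel A 0ℓ} {d : ℕ} →
                     DecidableEquality A → HasRealizer _≤_ d → Decidable _≤_
realizer⇒decidable _≟ᴬ_ (L , linear , realizes) x y =
  map′ (Equivalence.from (realizes x y)) (Equivalence.to (realizes x y))
       (all? λ k → L-decidable k x y)
  where
  L-decidable : ∀ k → Decidable (L k)
  L-decidable k = total∧dec⇒dec reflexive antisym total _≟ᴬ_
    where open IsTotalOrder (IsLinearExtension.isTotalOrder (linear k))

injective⇒isTotalOrder : {_≤_ : Rel B 0ℓ} → IsTotalOrder _≡_ _≤_ →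
                         (f : A → B) → Injective _≡_ _≡_ f → IsTotalOrder _≡_ (_≤_ on f)
injective⇒isTotalOrder ≤-isTotalOrder f f-injective = record
  { isPartialOrder = record
    { isPreorder = record
      { isEquivalence = isEquivalence
      ; reflexive     = λ { refl → reflexive refl }
      ; trans         = ≤-trans
      }
    ; antisym = λ x≤y y≤x → f-injective (antisym x≤y y≤x)
    }
  ; total = λ x y → total (f x) (f y)
  }
  where
  open IsTotalOrder ≤-isTotalOrder using (reflexive; antisym; total) renaming (trans to ≤-trans)

module _ {_≤_ : Rel (Fin n) 0ℓ} (≤-isDecPartialOrder : IsDecPartialOrder _≡_ _≤_) where
  open IsDecPartialOrder ≤-isDecPartialOrder using (_≤?_; reflexive; antisym)
    renaming (trans to ≤-trans)

  downSet : Fin n → Subset n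
  downSet y = tabulate λ x → does (x ≤? y)

  ∈-downSet⁺ : ∀ {x y} → x ≤ y → x ∈ downSet y
  ∈-downSet⁺ {x} {y} x≤y =
    lookup⇒[]= x (downSet y) (trans (lookup∘tabulate _ x) (dec-true (x ≤? y) x≤y))

  ∈-downSet⁻ : ∀ {x y} → x ∈ downSet y → x ≤ y
  ∈-downSet⁻ {x} {y} x∈ with x ≤? y | trans (sym (lookup∘tabulate _ x)) ([]=⇒lookup x∈)
  ... | yes x≤y | _ = x≤y
  ... | no  _   | ()

  downSet-⊂ : ∀ {x y} → x ≤ y → x ≢ y → downSet x ⊂ downSet y
  downSet-⊂ {x} {y} x≤y x≢y =
      (λ z∈ → ∈-downSet⁺ (≤-trans (∈-downSet⁻ z∈) x≤y))
    , y , ∈-downSet⁺ (reflexive refl) , λ y∈ → x≢y (antisym x≤y (∈-downSet⁻ y∈))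

  rank : Fin n → Fin (suc n)
  rank x = fromℕ< (s≤s (∣p∣≤n (downSet x)))

  -- Sorting by rank (the size of the down-set), ties broken by index.
  key : Fin n → Fin (suc n * n)
  key x = combine (rank x) x

  key-< : ∀ {x y} → x ≤ y → x ≢ y → key x < key y
  key-< {x} {y} x≤y x≢y = combine-monoˡ-< x y rank-<
    where
    rank-< : rank x < rank y
    rank-< = subst₂ Data.Nat._<_ (sym (toℕ-fromℕ< _)) (sym (toℕ-fromℕ< _))
                    (p⊂q⇒∣p∣<∣q∣ (downSet-⊂ x≤y x≢y))

  linearExtension : Σ (Rel (Fin n) 0ℓ) (IsLinearExtension _≤_)
  linearExtension = (F._≤_ on key) , record
    { isTotalOrder = injective⇒isTotalOrder ≤-isTotalOrder key
                       (λ {x} {y} → combine-injectiveʳ (rank x) x (rank y) y)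
    ; extends      = extends
    }
    where
    extends : ∀ {x y} → x ≤ y → key x F.≤ key y
    extends {x} {y} x≤y with x ≟ y
    ... | yes refl = ℕ-≤-refl
    ... | no  x≢y  = <⇒≤ (key-< x≤y x≢y)

module _ {C : Pred (Fin n) 0ℓ} (C-irrelevant : ∀ {x} → Irrelevant (C x)) where

  proj₁-injective : {a b : Σ (Fin n) C} → proj₁ a ≡ proj₁ b → a ≡ b
  proj₁-injective {x , c} {.x , c′} refl = cong (x ,_) (C-irrelevant c c′)

  Σ-≟ : DecidableEquality (Σ (Fin n) C)
  Σ-≟ a b = map′ proj₁-injective (cong proj₁) (proj₁ a ≟ proj₁ b)

  module _ (C? : U.Decidable C) where

    ∃? : {P : Pred (Σ (Fin n) C) 0ℓ} → U.Decidable P → Dec (∃ P)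
    ∃? {P} P? = map′ (λ (x , c , p) → (x , c) , p) (λ ((x , c) , p) → x , c , p)
                     (any? λ x → over x)
      where
      over : ∀ x → Dec (Σ (C x) λ c → P (x , c))
      over x with C? x
      ... | yes c = map′ (c ,_) (λ (c′ , p) → subst (λ c → P (x , c)) (C-irrelevant c′ c) p)
                         (P? (x , c))
      ... | no ¬c = no (¬c ∘ proj₁)

module ExtendFromSubposet {_≼_ : Rel (Fin n) 0ℓ} (≼-isDecPartialOrder : IsDecPartialOrder _≡_ _≼_)
  {C : Pred (Fin n) 0ℓ} (C? : U.Decidable C) (C-irrelevant : ∀ {x} → Irrelevant (C x))
  {L : Rel (Σ (Fin n) C) 0ℓ} (L-isLinearExtension : IsLinearExtension (_≼_ on proj₁) L) where

  open IsDecPartialOrder ≼-isDecPartialOrder using (_≤?_)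
    renaming (reflexive to ≼-reflexive; trans to ≼-trans; antisym to ≼-antisym)
  open IsLinearExtension L-isLinearExtension using () renaming (extends to ≼⇒L)
  open IsTotalOrder (IsLinearExtension.isTotalOrder L-isLinearExtension) using ()
    renaming (reflexive to L-reflexive; trans to L-trans; antisym to L-antisym; total to L-total)

  Through : Rel (Fin n) 0ℓ
  Through x y = ∃₂ λ a b → x ≼ proj₁ a × L a b × proj₁ b ≼ y

  _⊑_ : Rel (Fin n) 0ℓ
  x ⊑ y = x ≼ y ⊎ Through x y

  ⊑⇒L : ∀ {a b} → proj₁ a ⊑ proj₁ b → L a b
  ⊑⇒L (inj₁ a≼b) = ≼⇒L a≼b
  ⊑⇒L (inj₂ (a′ , b′ , a≼a′ , La′b′ , b′≼b)) = L-trans (≼⇒L a≼a′) (L-trans La′b′ (≼⇒L b′≼b))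

  ⊑-trans : ∀ {x y z} → x ⊑ y → y ⊑ z → x ⊑ z
  ⊑-trans (inj₁ x≼y) (inj₁ y≼z) = inj₁ (≼-trans x≼y y≼z)
  ⊑-trans (inj₁ x≼y) (inj₂ (a , b , y≼a , Lab , b≼z)) = inj₂ (a , b , ≼-trans x≼y y≼a , Lab , b≼z)
  ⊑-trans (inj₂ (a , b , x≼a , Lab , b≼y)) (inj₁ y≼z) = inj₂ (a , b , x≼a , Lab , ≼-trans b≼y y≼z)
  ⊑-trans (inj₂ (a , b , x≼a , Lab , b≼y)) (inj₂ (a′ , b′ , y≼a′ , La′b′ , b′≼z)) =
    inj₂ (a , b′ , x≼a , L-trans Lab (L-trans (≼⇒L (≼-trans b≼y y≼a′)) La′b′) , b′≼z)

  -- A detour through L that comes back forces a = b, so it collapses to x ≼ y.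
  ⊑-back⇒≼ : ∀ {x y} → x ⊑ y → y ⊑ x → x ≼ y
  ⊑-back⇒≼ (inj₁ x≼y) _ = x≼y
  ⊑-back⇒≼ {x} (inj₂ (a , b , x≼a , Lab , b≼y)) y⊑x =
    ≼-trans (subst (λ c → x ≼ proj₁ c) a≡b x≼a) b≼y
    where
    a≡b : a ≡ b
    a≡b = L-antisym Lab (⊑⇒L (⊑-trans (inj₁ b≼y) (⊑-trans y⊑x (inj₁ x≼a))))

  ⊑-antisym : ∀ {x y} → x ⊑ y → y ⊑ x → x ≡ y
  ⊑-antisym x⊑y y⊑x = ≼-antisym (⊑-back⇒≼ x⊑y y⊑x) (⊑-back⇒≼ y⊑x x⊑y)

  ⊑-decidable : Decidable _⊑_
  ⊑-decidable x y = x ≤? y ⊎-dec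
    ∃? C-irrelevant C? λ a → ∃? C-irrelevant C? λ b →
      x ≤? proj₁ a ×-dec L-decidable a b ×-dec proj₁ b ≤? y
    where
    L-decidable : Decidable L
    L-decidable = total∧dec⇒dec L-reflexive L-antisym L-total (Σ-≟ C-irrelevant)

  ⊑-isDecPartialOrder : IsDecPartialOrder _≡_ _⊑_
  ⊑-isDecPartialOrder = record
    { isPartialOrder = record
      { isPreorder = record
        { isEquivalence = isEquivalence
        ; reflexive     = λ { refl → inj₁ (≼-reflexive refl) }
        ; trans         = ⊑-trans
        }
      ; antisym = ⊑-antisym
      }
    ; _≟_  = _≟_
    ; _≤?_ = ⊑-decidable
    }

  extension : Σ (Rel (Fin n) 0ℓ) λ M →
              IsLinearExtension _≼_ M × (∀ a b → M (proj₁ a) (proj₁ b) → L a b)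
  extension with linearExtension ⊑-isDecPartialOrder
  ... | M , M-linear = M , record { isTotalOrder = isTotalOrder ; extends = extends ∘ inj₁ } , agrees
    where
    open IsLinearExtension M-linear
    agrees : ∀ a b → M (proj₁ a) (proj₁ b) → L a b
    agrees a b Mab with L-total a b
    ... | inj₁ Lab = Lab
    ... | inj₂ Lba = L-reflexive (proj₁-injective C-irrelevant
            (IsTotalOrder.antisym isTotalOrder Mab
               (extends (inj₂ (b , a , ≼-reflexive refl , Lba , ≼-reflexive refl)))))

InPair : (Fin n → Fin m) → Fin m → Fin m → Pred (Fin n) 0ℓ
InPair part i j x = part x ≡ i ⊎ part x ≡ j

InPair? : (part : Fin n → Fin m) (i j : Fin m) → U.Decidable (InPair part i j)
InPair? part i j x = part x ≟ i ⊎-dec part x ≟ j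

InPair-irrelevant : {part : Fin n → Fin m} {i j : Fin m} → i ≢ j →
                    ∀ {x} → Irrelevant (InPair part i j x)
InPair-irrelevant i≢j (inj₁ refl) (inj₁ refl) = refl
InPair-irrelevant i≢j (inj₂ refl) (inj₂ refl) = refl
InPair-irrelevant i≢j (inj₁ p)    (inj₂ q)    = ⊥-elim (i≢j (trans (sym p) q))
InPair-irrelevant i≢j (inj₂ p)    (inj₁ q)    = ⊥-elim (i≢j (trans (sym q) p))

pairContainingBlock : 2 ≤ m → (a : Fin m) → ∃₂ λ i j → i < j × (a ≡ i ⊎ a ≡ j)
pairContainingBlock (s≤s (s≤s _)) F.zero    = F.zero , F.suc F.zero , z<s , inj₁ refl
pairContainingBlock (s≤s (s≤s _)) (F.suc a) = F.zero , F.suc a , z<s , inj₂ refl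

pairContaining : 2 ≤ m → (a b : Fin m) →
                 ∃₂ λ i j → i < j × (a ≡ i ⊎ a ≡ j) × (b ≡ i ⊎ b ≡ j)
pairContaining 2≤m a b with <-cmp a b
... | tri< a<b _ _ = a , b , a<b , inj₁ refl , inj₂ refl
... | tri> _ _ b<a = b , a , b<a , inj₂ refl , inj₁ refl
... | tri≈ _ refl _ with pairContainingBlock 2≤m a
...   | i , j , i<j , a∈ = i , j , i<j , a∈ , a∈

module _ (2≤m : 2 ≤ m) {part : Fin n → Fin m} {_≼_ : Rel (Fin n) 0ℓ}
  (P : IsMPartite m n part _≼_) {D : Fin m → Fin m → ℕ}
  (realizer : ∀ i j → i < j → HasRealizer (pairRel part _≼_ i j) (D i j)) where

  open IsMPartite P using (isPartialOrder; antichain; upward)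
  open IsPartialOrder isPartialOrder using (reflexive)

  part-monotone : ∀ {x y} → x ≼ y → part x F.≤ part y
  part-monotone {x} {y} x≼y with x ≟ y
  ... | yes refl = ℕ-≤-refl
  ... | no  x≢y  = <⇒≤ (upward x y x≼y x≢y)

  ≼-decidable : Decidable _≼_
  ≼-decidable x y with <-cmp (part x) (part y)
  ... | tri< i<j _ _ = realizer⇒decidable (Σ-≟ (InPair-irrelevant {part = part} (<⇒≢ i<j)))
                         (realizer _ _ i<j) (x , inj₁ refl) (y , inj₂ refl)
  ... | tri≈ _ i≡j _ = map′ reflexive (antichain x y i≡j) (x ≟ y)
  ... | tri> _ _ j<i = no λ x≼y → <⇒≱ j<i (part-monotone x≼y)

  ≼-isDecPartialOrder : IsDecPartialOrder _≡_ _≼_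
  ≼-isDecPartialOrder = record
    { isPartialOrder = isPartialOrder ; _≟_ = _≟_ ; _≤?_ = ≼-decidable }

  module PairExtension (i j : Fin m) (i<j : i < j) (k : Fin (D i j)) =
    ExtendFromSubposet ≼-isDecPartialOrder (InPair? part i j) (InPair-irrelevant {part = part} (<⇒≢ i<j))
           (proj₁ (proj₂ (realizer i j i<j)) k)

  extensions : ∀ i j → i < j → Vector (Rel (Fin n) 0ℓ) (D i j)
  extensions i j i<j k = proj₁ (PairExtension.extension i j i<j k)

  extensions-linear : ∀ i j i<j → All (IsLinearExtension _≼_) (extensions i j i<j)
  extensions-linear i j i<j k = proj₁ (proj₂ (PairExtension.extension i j i<j k))

  extensions-realize : ∀ {x y} → (∀ i j i<j → All (λ M → M x y) (extensions i j i<j)) → x ≼ y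
  extensions-realize {x} {y} Mxy with pairContaining 2≤m (part x) (part y)
  ... | i , j , i<j , x∈ , y∈ =
    Equivalence.from (proj₂ (proj₂ (realizer i j i<j)) (x , x∈) (y , y∈))
      λ k → proj₂ (proj₂ (PairExtension.extension i j i<j k)) (x , x∈) (y , y∈) (Mxy i j i<j k)

  realizerOfPairs : HasRealizer _≼_ (sumPairs m D)
  realizerOfPairs =
      pairFamily extensions
    , All-pairFamily⁺ (IsLinearExtension _≼_) extensions extensions-linear
    , λ x y → mk⇔
        (λ x≼y → All-pairFamily⁺ (λ M → M x y) extensions
                   λ i j i<j k → IsLinearExtension.extends (extensions-linear i j i<j k) x≼y)
        (extensions-realize ∘ All-pairFamily⁻ (λ M → M x y) extensions)

mainTheorem4 : (m n : ℕ) → 2 ≤ m →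
    (part : Fin n → Fin m) (_≼_ : Rel (Fin n) 0ℓ) →
    IsMPartite m n part _≼_ →
    (D : Fin m → Fin m → ℕ) →
    (∀ i j → i < j → IsDimension (pairRel part _≼_ i j) (D i j)) →
    HasRealizer _≼_ (sumPairs m D)
mainTheorem4 m n 2≤m part _≼_ P D dimension =
  realizerOfPairs 2≤m P λ i j i<j → proj₁ (dimension i j i<j)
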